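{- Let $r$ be a positive integer and $p$ a prime. Then the set $$\left\{\begin{pmatrix}1 & 0 \\ p^r & 1\end{pmatrix},\ \begin{pmatrix}1 & 1 \\ 0 & 1\end{pmatrix}\right\}\subset \mathrm{SL}_2(\mathbb{Z}/p^{r+1}\mathbb{Z})$$ generates the subgroup $$\overline{\Gamma_1(p^r)} := \left\{\begin{pmatrix}1+p^r a & b\\ p^r c & 1+p^r d\end{pmatrix}\in \mathrm{SL}_2(\mathbb{Z}/p^{r+1}\mathbb{Z})\right\}.$$
   Context: Here $a,b,c,d$ range over integers (equivalently, $a,c,d$ may be taken modulo $p$ and $b$ modulo $p^{r+1}$), subject to the matrix having determinant $1$ in $\mathbb{Z}/p^{r+1}\mathbb{Z}$. -}

module Defs where

open import Data.Nat as ℕ using (ℕ)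
open import Data.Integer using (ℤ; +_; _+_; _-_; _*_; -_)
open import Data.Integer.Divisibility using (_∣_)
open import Data.Product using (_×_; ∃-syntax)
open import Data.Sum using (_⊎_)
open import Relation.Binary.PropositionalEquality using (_≡_)

-- 2×2 integer matrices ( a b ; c d ); elements of Mat₂(ℤ/Nℤ) are
-- represented by integer lifts, compared up to congruence mod N.
record M2 : Set where
  constructor mat
  field
    e11 e12 e21 e22 : ℤ
open M2 public

_≡[_]_ : ℤ → ℕ → ℤ → Set
x ≡[ N ] y = (+ N) ∣ (x - y)

_≈[_]_ : M2 → ℕ → M2 → Set
M ≈[ N ] M' =
  (e11 M ≡[ N ] e11 M') × (e12 M ≡[ N ] e12 M') ×
  (e21 M ≡[ N ] e21 M') × (e22 M ≡[ N ] e22 M')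

I₂ : M2
I₂ = mat (+ 1) (+ 0) (+ 0) (+ 1)

_⊗_ : M2 → M2 → M2
mat a b c d ⊗ mat a' b' c' d' =
  mat (a * a' + b * c') (a * b' + b * d') (c * a' + d * c') (c * b' + d * d')

det : M2 → ℤ
det (mat a b c d) = a * d - b * c

-- adjugate; for a matrix of determinant 1 this is its inverse
adj : M2 → M2
adj (mat a b c d) = mat d (- b) (- c) a

InSL2 : ℕ → M2 → Set
InSL2 N M = det M ≡[ N ] (+ 1)

data Generated (N : ℕ) (S : M2 → Set) : M2 → Set where
  gen   : ∀ {M} → S M → Generated N S M
  unit  : Generated N S I₂
  prod  : ∀ {M M'} → Generated N S M → Generated N S M' → Generated N S (M ⊗ M')
  inv   : ∀ {M} → Generated N S M → Generated N S (adj M)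
  resp  : ∀ {M M'} → M ≈[ N ] M' → Generated N S M → Generated N S M'

Gens : ℕ → ℕ → M2 → Set
Gens p r M = (M ≡ mat (+ 1) (+ 0) (+ (p ℕ.^ r)) (+ 1)) ⊎ (M ≡ mat (+ 1) (+ 1) (+ 0) (+ 1))

Gamma1bar : ℕ → ℕ → M2 → Set
Gamma1bar p r M =
  InSL2 (p ℕ.^ (ℕ.suc r)) M ×
  ∃[ a ] ∃[ b ] ∃[ c ] ∃[ d ]
    (M ≈[ p ℕ.^ (ℕ.suc r) ]
      mat (+ 1 + + (p ℕ.^ r) * a) b (+ (p ℕ.^ r) * c) (+ 1 + + (p ℕ.^ r) * d))

{-# OPTIONS --safe #-}
module Submission where

-- Write Q = p ^ r, N = p ^ (r + 1), T b = (1 b ; 0 1) and L c = (1 0 ; c 1).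
-- Modulo Q both generators are upper unitriangular, and the matrices of
-- determinant 1 mod N that are upper unitriangular mod Q are closed under
-- products, adjugates and congruence mod N (as Q ∣ N); this is one inclusion.
-- Conversely the group contains every T b and L (Q c), and since N ∣ Q² a
-- matrix F = (1 + QA  B ; QC  1 + QD) of determinant 1 factors mod N as
--   L (QD) · T 1 · L (-QD) · T ((B - 1)(1 + QD)) · L (QC).
-- Mod Q² the first three factors give (1 - QD  1 ; 0  1 + QD), the fourth
-- moves B into place, and the last produces the top-left entry 1 - QD + QBC,
-- which is 1 + QA because det F ≡ 1 forces Q (A + D - BC) ≡ 0 mod N.

open import Defs
open import Data.Nat as ℕ using (ℕ; _≤_; _^_; suc)
open import Data.Nat.Divisibility as ℕ using (n∣m*n)
open import Data.Nat.Primality using (Prime)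
open import Data.Integer using (ℤ; +_; -[1+_]; _+_; _-_; _*_; -_)
open import Data.Integer.Properties
  using (+-identityˡ; +-identityʳ; *-comm; *-identityʳ; *-zeroʳ; neg-distribʳ-*; pos-*)
import Data.Integer.Divisibility.Signed as Signed
open import Data.Integer.Tactic.RingSolver using (solve-∀; solve)
open import Data.Nat.Tactic.RingSolver using () renaming (solve-∀ to ℕ-solve-∀)
open import Data.List using (_∷_; [])
open import Data.Product using (_×_; _,_; ∃-syntax)
open import Data.Sum using (inj₁; inj₂)
open import Relation.Binary.Bundles using (Setoid)
open import Relation.Binary.Structures using (IsEquivalence)
import Relation.Binary.Reasoning.Setoid
open import Relation.Binary.PropositionalEquality
  using (_≡_; refl; sym; trans; subst; cong; module ≡-Reasoning)

-- x ≡[ n ] y unfolds to divisibility between absolute values, from which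
-- Agda cannot recover x and y; this record is the same relation, made
-- injective so that implicit arguments get inferred.
infix 4 _≡_[mod_]
record _≡_[mod_] (x y : ℤ) (n : ℕ) : Set where
  constructor ∣-difference
  field divides : + n Signed.∣ (x - y)
open _≡_[mod_]

≡[]⇒≡mod : ∀ {n x y} → x ≡[ n ] y → x ≡ y [mod n ]
≡[]⇒≡mod {x = x} {y} x≡y = ∣-difference (Signed.∣ᵤ⇒∣ {i = x - y} x≡y)

≡mod⇒≡[] : ∀ {n x y} → x ≡ y [mod n ] → x ≡[ n ] y
≡mod⇒≡[] x≡y = Signed.∣⇒∣ᵤ (divides x≡y)

module _ {n : ℕ} where

  ≡mod-intro : ∀ {x y e} → + n Signed.∣ e → x - y ≡ e → x ≡ y [mod n ]
  ≡mod-intro n∣e eq = ∣-difference (subst (+ n Signed.∣_) (sym eq) n∣e)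

  ≡mod-refl : ∀ {x} → x ≡ x [mod n ]
  ≡mod-refl {x} = ≡mod-intro (Signed.divides (+ 0) refl) (solve (x ∷ []))

  ≡mod-reflexive : ∀ {x y} → x ≡ y → x ≡ y [mod n ]
  ≡mod-reflexive refl = ≡mod-refl

  ≡mod-sym : ∀ {x y} → x ≡ y [mod n ] → y ≡ x [mod n ]
  ≡mod-sym {x} {y} x≡y = ≡mod-intro (Signed.∣m⇒∣-m (divides x≡y)) (solve (x ∷ y ∷ []))

  ≡mod-trans : ∀ {x y z} → x ≡ y [mod n ] → y ≡ z [mod n ] → x ≡ z [mod n ]
  ≡mod-trans {x} {y} {z} x≡y y≡z =
    ≡mod-intro (Signed.∣m∣n⇒∣m+n (divides x≡y) (divides y≡z)) (solve (x ∷ y ∷ z ∷ []))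

  +-cong-mod : ∀ {x x' y y'} → x ≡ x' [mod n ] → y ≡ y' [mod n ] → x + y ≡ x' + y' [mod n ]
  +-cong-mod {x} {x'} {y} {y'} x≡x' y≡y' =
    ≡mod-intro (Signed.∣m∣n⇒∣m+n (divides x≡x') (divides y≡y')) (solve (x ∷ x' ∷ y ∷ y' ∷ []))

  -‿cong-mod : ∀ {x x'} → x ≡ x' [mod n ] → - x ≡ - x' [mod n ]
  -‿cong-mod {x} {x'} x≡x' = ≡mod-intro (Signed.∣m⇒∣-m (divides x≡x')) (solve (x ∷ x' ∷ []))

  *-cong-mod : ∀ {x x' y y'} → x ≡ x' [mod n ] → y ≡ y' [mod n ] → x * y ≡ x' * y' [mod n ]
  *-cong-mod {x} {x'} {y} {y'} x≡x' y≡y' =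
    ≡mod-intro (Signed.∣m∣n⇒∣m+n (Signed.∣m⇒∣m*n y (divides x≡x')) (Signed.∣n⇒∣m*n x' (divides y≡y')))
               (solve (x ∷ x' ∷ y ∷ y' ∷ []))

  ≡mod-isEquivalence : IsEquivalence _≡_[mod n ]
  ≡mod-isEquivalence = record { refl = ≡mod-refl ; sym = ≡mod-sym ; trans = ≡mod-trans }

  ≡mod-setoid : Setoid _ _
  ≡mod-setoid = record { isEquivalence = ≡mod-isEquivalence }

module ≡mod-Reasoning (n : ℕ) = Relation.Binary.Reasoning.Setoid (≡mod-setoid {n})

≡mod-divisor : ∀ {m n x y} → m ℕ.∣ n → x ≡ y [mod n ] → x ≡ y [mod m ]
≡mod-divisor m∣n x≡y = ∣-difference (Signed.∣-trans (Signed.∣ᵤ⇒∣ m∣n) (divides x≡y))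

infix 4 _≈_[mod_]
record _≈_[mod_] (M M' : M2) (n : ℕ) : Set where
  constructor entrywise
  field
    e11≡ : e11 M ≡ e11 M' [mod n ]
    e12≡ : e12 M ≡ e12 M' [mod n ]
    e21≡ : e21 M ≡ e21 M' [mod n ]
    e22≡ : e22 M ≡ e22 M' [mod n ]

≈[]⇒≈mod : ∀ {n} M M' → M ≈[ n ] M' → M ≈ M' [mod n ]
≈[]⇒≈mod M M' (h₁₁ , h₁₂ , h₂₁ , h₂₂) = entrywise
  (≡[]⇒≡mod {x = e11 M} h₁₁) (≡[]⇒≡mod {x = e12 M} h₁₂)
  (≡[]⇒≡mod {x = e21 M} h₂₁) (≡[]⇒≡mod {x = e22 M} h₂₂)

≈mod⇒≈[] : ∀ {n M M'} → M ≈ M' [mod n ] → M ≈[ n ] M'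
≈mod⇒≈[] (entrywise h₁₁ h₁₂ h₂₁ h₂₂) = ≡mod⇒≡[] h₁₁ , ≡mod⇒≡[] h₁₂ , ≡mod⇒≡[] h₂₁ , ≡mod⇒≡[] h₂₂

-- Stated for explicit matrices, so that the entries of a product of two
-- explicit matrices reach the ring solver as polynomials.
mat-≈mod : ∀ {n a b c d a' b' c' d'} →
  a ≡ a' [mod n ] → b ≡ b' [mod n ] → c ≡ c' [mod n ] → d ≡ d' [mod n ] →
  mat a b c d ≈ mat a' b' c' d' [mod n ]
mat-≈mod = entrywise

≈mod-sym : ∀ {n M M'} → M ≈ M' [mod n ] → M' ≈ M [mod n ]
≈mod-sym (entrywise h₁₁ h₁₂ h₂₁ h₂₂) = entrywise (≡mod-sym h₁₁) (≡mod-sym h₁₂) (≡mod-sym h₂₁) (≡mod-sym h₂₂)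

det-⊗ : ∀ M M' → det (M ⊗ M') ≡ det M * det M'
det-⊗ (mat a b c d) (mat a' b' c' d') = binet a b c d a' b' c' d'
  where
  binet : ∀ a b c d a' b' c' d' →
    (a * a' + b * c') * (c * b' + d * d') - (a * b' + b * d') * (c * a' + d * c') ≡
    (a * d - b * c) * (a' * d' - b' * c')
  binet = solve-∀

det-adj : ∀ M → det (adj M) ≡ det M
det-adj (mat a b c d) = swap a b c d
  where
  swap : ∀ a b c d → d * a - (- b) * (- c) ≡ a * d - b * c
  swap = solve-∀

det-cong : ∀ {n M M'} → M ≈ M' [mod n ] → det M ≡ det M' [mod n ]
det-cong (entrywise h₁₁ h₁₂ h₂₁ h₂₂) = +-cong-mod (*-cong-mod h₁₁ h₂₂) (-‿cong-mod (*-cong-mod h₁₂ h₂₁))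

record Γ₁ (N Q : ℕ) (M : M2) : Set where
  field
    det≡1 : det M ≡ + 1 [mod N ]
    e11≡1 : e11 M ≡ + 1 [mod Q ]
    e21≡0 : e21 M ≡ + 0 [mod Q ]
    e22≡1 : e22 M ≡ + 1 [mod Q ]
open Γ₁

module _ {N Q : ℕ} where

  Γ₁-I₂ : Γ₁ N Q I₂
  Γ₁-I₂ = record { det≡1 = ≡mod-refl ; e11≡1 = ≡mod-refl ; e21≡0 = ≡mod-refl ; e22≡1 = ≡mod-refl }

  Γ₁-upper : ∀ b → Γ₁ N Q (mat (+ 1) b (+ 0) (+ 1))
  Γ₁-upper b = record
    { det≡1 = ≡mod-reflexive (cong (λ t → + 1 - t) (*-zeroʳ b))
    ; e11≡1 = ≡mod-refl ; e21≡0 = ≡mod-refl ; e22≡1 = ≡mod-refl }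

  Γ₁-lower : Γ₁ N Q (mat (+ 1) (+ 0) (+ Q) (+ 1))
  Γ₁-lower = record
    { det≡1 = ≡mod-refl
    ; e11≡1 = ≡mod-refl
    ; e21≡0 = ≡mod-intro Signed.∣-refl (+-identityʳ (+ Q))
    ; e22≡1 = ≡mod-refl }

  Γ₁-⊗ : ∀ M M' → Γ₁ N Q M → Γ₁ N Q M' → Γ₁ N Q (M ⊗ M')
  Γ₁-⊗ M@(mat a b c d) M'@(mat a' b' c' d') γ γ' = record
    { det≡1 = let open ≡mod-Reasoning N in begin
        det (M ⊗ M')      ≡⟨ det-⊗ M M' ⟩
        det M * det M'    ≈⟨ *-cong-mod (det≡1 γ) (det≡1 γ') ⟩
        + 1               ∎
    ; e11≡1 = let open ≡mod-Reasoning Q in begin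
        a * a' + b * c'   ≈⟨ +-cong-mod (*-cong-mod (e11≡1 γ) (e11≡1 γ'))
                                        (*-cong-mod (≡mod-refl {x = b}) (e21≡0 γ')) ⟩
        + 1 + b * + 0     ≡⟨ solve (b ∷ []) ⟩
        + 1               ∎
    ; e21≡0 = let open ≡mod-Reasoning Q in begin
        c * a' + d * c'   ≈⟨ +-cong-mod (*-cong-mod (e21≡0 γ) (e11≡1 γ'))
                                        (*-cong-mod (e22≡1 γ) (e21≡0 γ')) ⟩
        + 0               ∎
    ; e22≡1 = let open ≡mod-Reasoning Q in begin
        c * b' + d * d'   ≈⟨ +-cong-mod (*-cong-mod (e21≡0 γ) (≡mod-refl {x = b'}))
                                        (*-cong-mod (e22≡1 γ) (e22≡1 γ')) ⟩
        + 1               ∎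
    }

  Γ₁-adj : ∀ M → Γ₁ N Q M → Γ₁ N Q (adj M)
  Γ₁-adj M@(mat _ _ _ _) γ = record
    { det≡1 = ≡mod-trans (≡mod-reflexive (det-adj M)) (det≡1 γ)
    ; e11≡1 = e22≡1 γ
    ; e21≡0 = -‿cong-mod (e21≡0 γ)
    ; e22≡1 = e11≡1 γ }

  Γ₁-resp : Q ℕ.∣ N → ∀ M M' → M ≈[ N ] M' → Γ₁ N Q M → Γ₁ N Q M'
  Γ₁-resp Q∣N M M' M≈M' γ with ≈[]⇒≈mod M M' M≈M'
  ... | M≈M'@(entrywise h₁₁ _ h₂₁ h₂₂) = record
    { det≡1 = ≡mod-trans (≡mod-sym (det-cong M≈M')) (det≡1 γ)
    ; e11≡1 = ≡mod-trans (≡mod-sym (≡mod-divisor Q∣N h₁₁)) (e11≡1 γ)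
    ; e21≡0 = ≡mod-trans (≡mod-sym (≡mod-divisor Q∣N h₂₁)) (e21≡0 γ)
    ; e22≡1 = ≡mod-trans (≡mod-sym (≡mod-divisor Q∣N h₂₂)) (e22≡1 γ) }

  Generated⇒Γ₁ : ∀ {S} → Q ℕ.∣ N → (∀ {M} → S M → Γ₁ N Q M) →
                 ∀ {M} → Generated N S M → Γ₁ N Q M
  Generated⇒Γ₁ Q∣N S⊆Γ₁ (gen s)                = S⊆Γ₁ s
  Generated⇒Γ₁ Q∣N S⊆Γ₁ unit                   = Γ₁-I₂
  Generated⇒Γ₁ Q∣N S⊆Γ₁ (prod {M} {M'} g g')   =
    Γ₁-⊗ M M' (Generated⇒Γ₁ Q∣N S⊆Γ₁ g) (Generated⇒Γ₁ Q∣N S⊆Γ₁ g')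
  Generated⇒Γ₁ Q∣N S⊆Γ₁ (inv {M} g)            = Γ₁-adj M (Generated⇒Γ₁ Q∣N S⊆Γ₁ g)
  Generated⇒Γ₁ Q∣N S⊆Γ₁ (resp {M} {M'} M≈M' g) = Γ₁-resp Q∣N M M' M≈M' (Generated⇒Γ₁ Q∣N S⊆Γ₁ g)

≡mod⇒multiple : ∀ {n x y} → x ≡ y [mod n ] → ∃[ k ] x ≡ y + + n * k
≡mod⇒multiple {n} {x} {y} x≡y with divides x≡y
... | Signed.divides k x-y≡k*n = k , (begin
  x                ≡⟨ solve (x ∷ y ∷ []) ⟩
  y + (x - y)      ≡⟨ cong (_+_ y) x-y≡k*n ⟩
  y + k * + n      ≡⟨ cong (_+_ y) (*-comm k (+ n)) ⟩
  y + + n * k      ∎)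
  where open ≡-Reasoning

Γ₁⇒standardForm : ∀ {N Q M} → Γ₁ N Q M →
  ∃[ a ] ∃[ b ] ∃[ c ] ∃[ d ] (M ≈[ N ] mat (+ 1 + + Q * a) b (+ Q * c) (+ 1 + + Q * d))
Γ₁⇒standardForm {M = mat a b c d} γ
  with ≡mod⇒multiple (e11≡1 γ) | ≡mod⇒multiple (e21≡0 γ) | ≡mod⇒multiple (e22≡1 γ)
... | k₁₁ , a≡ | k₂₁ , c≡ | k₂₂ , d≡ =
  k₁₁ , b , k₂₁ , k₂₂ ,
  ≈mod⇒≈[] (mat-≈mod (≡mod-reflexive a≡) (≡mod-refl {x = b})
                      (≡mod-reflexive (trans c≡ (+-identityˡ _))) (≡mod-reflexive d≡))

mat-cong : ∀ {a b c d a' b' c' d'} → a ≡ a' → b ≡ b' → c ≡ c' → d ≡ d' → mat a b c d ≡ mat a' b' c' d'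
mat-cong refl refl refl refl = refl

lower⊗upper : ∀ x y → mat (+ 1) (+ 0) x (+ 1) ⊗ mat (+ 1) y (+ 0) (+ 1) ≡ mat (+ 1) y x (+ 1 + x * y)
lower⊗upper x y = mat-cong (solve (x ∷ y ∷ [])) (solve (x ∷ y ∷ [])) (solve (x ∷ y ∷ [])) (solve (x ∷ y ∷ []))

oneParameterSubgroup-generated : ∀ {N S} (X : ℤ → M2) →
  (∀ y z → X y ⊗ X z ≡ X (y + z)) → (∀ z → adj (X z) ≡ X (- z)) →
  Generated N S (X (+ 1)) → ∀ z → Generated N S (X z)
oneParameterSubgroup-generated {N} {S} X X-+ X-neg X₁ = X-generated
  where
  X-natural : ∀ n → Generated N S (X (+ n))
  X-natural ℕ.zero    = subst (Generated N S) (X-+ (+ 1) (- + 1))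
                              (prod X₁ (subst (Generated N S) (X-neg (+ 1)) (inv X₁)))
  X-natural (ℕ.suc n) = subst (Generated N S) (X-+ (+ 1) (+ n)) (prod X₁ (X-natural n))

  X-generated : ∀ z → Generated N S (X z)
  X-generated (+ n)    = X-natural n
  X-generated -[1+ n ] = subst (Generated N S) (X-neg (+ suc n)) (inv (X-natural (suc n)))

module _ {N : ℕ} {S : M2 → Set} (q : ℤ) (N∣q² : + N Signed.∣ q * q)
         (lower∈S : S (mat (+ 1) (+ 0) q (+ 1))) (upper∈S : S (mat (+ 1) (+ 1) (+ 0) (+ 1))) where

  upper-generated : ∀ b → Generated N S (mat (+ 1) b (+ 0) (+ 1))
  upper-generated = oneParameterSubgroup-generated (λ b → mat (+ 1) b (+ 0) (+ 1))
    (λ y z → mat-cong (solve (y ∷ z ∷ [])) (solve (y ∷ z ∷ [])) refl (solve (y ∷ z ∷ [])))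
    (λ _ → refl)
    (gen upper∈S)

  lower-generated : ∀ c → Generated N S (mat (+ 1) (+ 0) (q * c) (+ 1))
  lower-generated = oneParameterSubgroup-generated (λ c → mat (+ 1) (+ 0) (q * c) (+ 1))
    (λ y z → mat-cong (solve (q ∷ y ∷ z ∷ [])) refl (solve (q ∷ y ∷ z ∷ [])) (solve (q ∷ y ∷ z ∷ [])))
    (λ c → cong (λ t → mat (+ 1) (+ 0) t (+ 1)) (neg-distribʳ-* q c))
    (subst (λ t → Generated N S (mat (+ 1) (+ 0) t (+ 1))) (sym (*-identityʳ q)) (gen lower∈S))

  ≡mod-q² : ∀ {x y} w → x - y ≡ q * q * w → x ≡ y [mod N ]
  ≡mod-q² w eq = ≡mod-intro (Signed.∣m⇒∣m*n w N∣q²) eq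

  conjugate-upper : ∀ D →
    ((mat (+ 1) (+ 0) (q * D) (+ 1) ⊗ mat (+ 1) (+ 1) (+ 0) (+ 1)) ⊗ mat (+ 1) (+ 0) (q * - D) (+ 1))
      ≈ mat (+ 1 - q * D) (+ 1) (+ 0) (+ 1 + q * D) [mod N ]
  conjugate-upper D =
    subst (λ X → X ⊗ mat (+ 1) (+ 0) (q * - D) (+ 1) ≈ mat (+ 1 - q * D) (+ 1) (+ 0) (+ 1 + q * D) [mod N ])
          (sym (lower⊗upper (q * D) (+ 1)))
          (mat-≈mod (≡mod-reflexive (solve (q ∷ D ∷ [])))
                    (≡mod-reflexive (solve (q ∷ D ∷ [])))
                    (≡mod-q² (- (D * D)) (solve (q ∷ D ∷ [])))
                    (≡mod-reflexive (solve (q ∷ D ∷ []))))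

  triangular-⊗-upper : ∀ B D →
    mat (+ 1 - q * D) (+ 1) (+ 0) (+ 1 + q * D) ⊗ mat (+ 1) ((B - + 1) * (+ 1 + q * D)) (+ 0) (+ 1)
      ≈ mat (+ 1 - q * D) B (+ 0) (+ 1 + q * D) [mod N ]
  triangular-⊗-upper B D = mat-≈mod
    (≡mod-reflexive (solve (q ∷ B ∷ D ∷ [])))
    (≡mod-q² (- ((B - + 1) * (D * D))) (solve (q ∷ B ∷ D ∷ [])))
    (≡mod-reflexive (solve (q ∷ B ∷ D ∷ [])))
    (≡mod-reflexive (solve (q ∷ B ∷ D ∷ [])))

  triangular-⊗-lower : ∀ A B C D →
    (+ 1 + q * A) * (+ 1 + q * D) - B * (q * C) ≡ + 1 [mod N ] →
    mat (+ 1 - q * D) B (+ 0) (+ 1 + q * D) ⊗ mat (+ 1) (+ 0) (q * C) (+ 1)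
      ≈ mat (+ 1 + q * A) B (q * C) (+ 1 + q * D) [mod N ]
  triangular-⊗-lower A B C D det≡1 = mat-≈mod
    (≡mod-intro (Signed.∣m∣n⇒∣m+n (Signed.∣m⇒∣-m (divides det≡1)) (Signed.∣m⇒∣m*n (A * D) N∣q²))
                (solve (q ∷ A ∷ B ∷ C ∷ D ∷ [])))
    (≡mod-reflexive (solve (q ∷ B ∷ D ∷ [])))
    (≡mod-q² (D * C) (solve (q ∷ C ∷ D ∷ [])))
    (≡mod-reflexive (solve (q ∷ D ∷ [])))

  standardForm-generated : ∀ A B C D →
    (+ 1 + q * A) * (+ 1 + q * D) - B * (q * C) ≡ + 1 [mod N ] →
    Generated N S (mat (+ 1 + q * A) B (q * C) (+ 1 + q * D))
  standardForm-generated A B C D det≡1 =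
    resp (≈mod⇒≈[] (triangular-⊗-lower A B C D det≡1)) (prod triangular (lower-generated C))
    where
    diagonal : Generated N S (mat (+ 1 - q * D) (+ 1) (+ 0) (+ 1 + q * D))
    diagonal = resp (≈mod⇒≈[] (conjugate-upper D))
                    (prod (prod (lower-generated D) (upper-generated (+ 1))) (lower-generated (- D)))

    triangular : Generated N S (mat (+ 1 - q * D) B (+ 0) (+ 1 + q * D))
    triangular = resp (≈mod⇒≈[] (triangular-⊗-upper B D))
                      (prod diagonal (upper-generated ((B - + 1) * (+ 1 + q * D))))

  standardForm⇒Generated : ∀ {M A B C D} → InSL2 N M →
    M ≈[ N ] mat (+ 1 + q * A) B (q * C) (+ 1 + q * D) → Generated N S M
  standardForm⇒Generated {M} {A} {B} {C} {D} detM≡1 M≈F =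
    resp (≈mod⇒≈[] (≈mod-sym M≈ₘF)) (standardForm-generated A B C D detF≡1)
    where
    M≈ₘF : M ≈ mat (+ 1 + q * A) B (q * C) (+ 1 + q * D) [mod N ]
    M≈ₘF = ≈[]⇒≈mod M _ M≈F

    detF≡1 : (+ 1 + q * A) * (+ 1 + q * D) - B * (q * C) ≡ + 1 [mod N ]
    detF≡1 = ≡mod-trans (≡mod-sym (det-cong M≈ₘF)) (≡[]⇒≡mod {x = det M} detM≡1)

p^[2+k]∣p^[1+k]*p^[1+k] : ∀ p k → p ^ suc (suc k) ℕ.∣ p ^ suc k ℕ.* p ^ suc k
p^[2+k]∣p^[1+k]*p^[1+k] p k = ℕ.divides (p ^ k) (square p (p ^ k))
  where
  square : ∀ p x → (p ℕ.* x) ℕ.* (p ℕ.* x) ≡ x ℕ.* (p ℕ.* (p ℕ.* x))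
  square = ℕ-solve-∀

lemma3p2 : (p r : ℕ) → Prime p → 1 ≤ r → (M : M2) →
    (Generated (p ^ suc r) (Gens p r) M → Gamma1bar p r M) ×
    (Gamma1bar p r M → Generated (p ^ suc r) (Gens p r) M)
lemma3p2 p ℕ.zero _ () M
lemma3p2 p r@(suc k) _ _ M = generated⇒Gamma1bar , Gamma1bar⇒generated
  where
  Gens⊆Γ₁ : ∀ {M} → Gens p r M → Γ₁ (p ^ suc r) (p ^ r) M
  Gens⊆Γ₁ (inj₁ refl) = Γ₁-lower
  Gens⊆Γ₁ (inj₂ refl) = Γ₁-upper (+ 1)

  generated⇒Gamma1bar : Generated (p ^ suc r) (Gens p r) M → Gamma1bar p r M
  generated⇒Gamma1bar g = ≡mod⇒≡[] (det≡1 γ) , Γ₁⇒standardForm γ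
    where
    γ : Γ₁ (p ^ suc r) (p ^ r) M
    γ = Generated⇒Γ₁ (n∣m*n p) Gens⊆Γ₁ g

  p^[1+r]∣p^r*p^r : + (p ^ suc r) Signed.∣ + (p ^ r) * + (p ^ r)
  p^[1+r]∣p^r*p^r = subst (+ (p ^ suc r) Signed.∣_) (pos-* (p ^ r) (p ^ r))
                          (Signed.∣ᵤ⇒∣ (p^[2+k]∣p^[1+k]*p^[1+k] p k))

  Gamma1bar⇒generated : Gamma1bar p r M → Generated (p ^ suc r) (Gens p r) M
  Gamma1bar⇒generated (det≡1 , _ , _ , _ , _ , M≈F) =
    standardForm⇒Generated (+ (p ^ r)) p^[1+r]∣p^r*p^r (inj₁ refl) (inj₂ refl) det≡1 M≈F
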